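{- Let $A$ be a $\delta_L$-algebra and let $d\in \mathrm{Rad}(A)$ (the Jacobson radical). The following are equivalent: (i) $d$ is distinguished; (ii) the ideal $(d)$ contains a distinguished element; (iii) $\pi\in (d^q,\phi(d))$; (iv) $\pi\in (d,\phi(d))$.
   Context: $L/\mathbb{Q}_p$ finite, $\mathcal{O}_L$, uniformizer $\pi$, $q=\#\mathcal{O}_L/\pi$. A $\delta_L$-algebra is an $\mathcal{O}_L$-algebra $A$ with a map of sets $\delta_L:A\to A$ satisfying $\delta_L(\alpha)=(\alpha-\alpha^q)/\pi$ for $\alpha\in\mathcal{O}_L$, $\delta_L(xy)=\delta_L(x)y^q+x^q\delta_L(y)+\pi\delta_L(x)\delta_L(y)$, and $\delta_L(x+y)=\delta_L(x)+\delta_L(y)-\sum_{i=1}^{q-1}\frac1\pi\binom qix^iy^{q-i}$; $\phi(x)=x^q+\pi\delta_L(x)$ is a ring endomorphism. An element $d\in A$ is distinguished if $\delta_L(d)\in A^\times$. -}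

module Defs where

open import Level using (Level; _⊔_)
open import Data.Nat using (ℕ; zero; suc; _∸_; _≤_; _<_)
open import Data.Nat.Combinatorics using (_C_)
open import Data.Fin using (Fin)
open import Data.Product using (Σ; ∃; _×_; _,_)
open import Data.Sum using (_⊎_)
open import Relation.Nullary using (¬_)
open import Relation.Binary.PropositionalEquality using (_≡_)
open import Algebra.Bundles using (CommutativeRing; Semiring)
open import Algebra.Morphism.Structures using (module RingMorphisms)
import Algebra.Definitions.RawSemiring as RS

module RingNotions {c ℓ} (R : CommutativeRing c ℓ) where
  open CommutativeRing R
  open RS (Semiring.rawSemiring (CommutativeRing.semiring R)) public using (_^_)

  _∣ᴿ_ : Carrier → Carrier → Set (c ⊔ ℓ)
  a ∣ᴿ b = ∃ λ k → b ≈ a * k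

  IsUnit : Carrier → Set (c ⊔ ℓ)
  IsUnit u = ∃ λ v → u * v ≈ 1#

  fromℕ : ℕ → Carrier
  fromℕ zero    = 0#
  fromℕ (suc n) = fromℕ n + 1#

  sum1to : ℕ → (ℕ → Carrier) → Carrier
  sum1to zero    f = 0#
  sum1to (suc n) f = sum1to n f + f (suc n)

  InJacobson : Carrier → Set (c ⊔ ℓ)
  InJacobson d = ∀ x → IsUnit (1# - x * d)

  InPrincipal : Carrier → Carrier → Set (c ⊔ ℓ)
  InPrincipal d e = ∃ λ f → e ≈ f * d

  InIdeal2 : Carrier → Carrier → Carrier → Set (c ⊔ ℓ)
  InIdeal2 u v e = ∃ λ a → ∃ λ b → e ≈ a * u + b * v

-- (O, π, q) is the ring of integers O_L of a finite extension L/ℚ_p,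
-- π a uniformizer, q = #O_L/π.  Characterised as: a complete discrete
-- valuation ring of characteristic 0 with uniformizer π and finite
-- residue field with exactly q elements.

record IsIntegersOfLocalField {c ℓ} (O : CommutativeRing c ℓ)
         (π : CommutativeRing.Carrier O) (q : ℕ) : Set (c ⊔ ℓ) where
  open CommutativeRing O
  open RingNotions O
  field
    1≉0          : ¬ (1# ≈ 0#)
    noZeroDivs   : ∀ x y → x * y ≈ 0# → x ≈ 0# ⊎ y ≈ 0#
    char0        : ∀ n → ¬ (fromℕ (suc n) ≈ 0#)
    π≉0          : ¬ (π ≈ 0#)
    π-nonunit    : ¬ IsUnit π
    dvr          : ∀ x → ¬ (x ≈ 0#) → ∃ λ u → ∃ λ n → IsUnit u × (x ≈ u * π ^ n)
    complete     : (s : ℕ → Carrier) → (∀ n → (π ^ n) ∣ᴿ (s (suc n) - s n)) →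
                   ∃ λ l → ∀ n → (π ^ n) ∣ᴿ (l - s n)
    residueRep   : Fin q → Carrier
    residueOnto  : ∀ x → ∃ λ i → π ∣ᴿ (x - residueRep i)
    residueInj   : ∀ i j → π ∣ᴿ (residueRep i - residueRep j) → i ≡ j

record DeltaLAlgebra {c ℓ} (O : CommutativeRing c ℓ)
         (π : CommutativeRing.Carrier O) (q : ℕ) (a ℓ′ : Level)
         : Set (c ⊔ ℓ ⊔ Level.suc (a ⊔ ℓ′)) where
  field
    A : CommutativeRing a ℓ′
  private
    module O = CommutativeRing O
    module OR = RingNotions O
  open CommutativeRing A
  open RingNotions A
  open RingMorphisms (CommutativeRing.rawRing O) rawRing
  field
    ι        : O.Carrier → Carrier
    ι-hom    : IsRingHomomorphism ι
    δ        : Carrier → Carrier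
    δ-cong   : ∀ {x y} → x ≈ y → δ x ≈ δ y
    δ-const  : ∀ α γ → π O.* γ O.≈ α O.- α OR.^ q → δ (ι α) ≈ ι γ
    δ-mul    : ∀ x y → δ (x * y) ≈ δ x * y ^ q + x ^ q * δ y + ι π * δ x * δ y
    δ-add    : (b : ℕ → O.Carrier) →
               (∀ i → 1 ≤ i → i < q → OR.fromℕ (q C i) O.≈ π O.* b i) →
               ∀ x y → δ (x + y) ≈ δ x + δ y
                        - sum1to (q ∸ 1) (λ i → ι (b i) * x ^ i * y ^ (q ∸ i))

  φ : Carrier → Carrier
  φ x = x ^ q + ι π * δ x

  Distinguished : Carrier → Set (a ⊔ ℓ′)
  Distinguished d = IsUnit (δ d)

-- Let J = (δd, d).  As d ∈ Rad(A), δd is a unit as soon as 1 ∈ J; and J contains φ(d)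
-- and, by the product rule, δ(fd) for every f, which already gives (ii) ⇒ (i).
-- For (iv) ⇒ (i) write π = ad + bφ(d).  Then π ∈ J and πu = cd with u = 1 - bδd ≡ 1 mod J.
-- Applying δ, the product rule gives δ(π)u^q ≡ δ(cd) ≡ 0 mod J, while δ(π) = 1 - π^(q-1) ≡ 1
-- because q ≥ 2 (the residue field contains 0 ≠ 1).  Hence 1 ≡ u^q ≡ 0 mod J.

module Submission where

open import Defs
open import Level using (Level)
open import Data.Nat as ℕ using (ℕ; zero; suc; _≤_; z≤n; s≤s)
import Data.Nat.Properties as ℕ
open import Data.Integer as ℤ using (ℤ; +_; -[1+_]; _⊖_)
import Data.Integer.Properties as ℤ
open import Data.Sign as Sign using (Sign)
open import Data.Maybe using (Maybe; just; nothing)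
open import Data.Fin using (Fin)
open import Data.Product using (∃; _×_; _,_)
open import Data.Empty using (⊥-elim)
open import Function.Base using (_∘_)
open import Function.Bundles using (_⇔_; mk⇔)
open import Relation.Nullary using (yes; no)
open import Relation.Binary.Core using (Rel)
open import Relation.Binary.Bundles using (Preorder)
import Relation.Binary.Reasoning.Preorder
import Relation.Binary.PropositionalEquality as ≡
open import Algebra.Bundles using (CommutativeRing)
open import Algebra.Morphism.Structures using (module RingMorphisms)
import Algebra.Solver.Ring.AlmostCommutativeRing as ACR

-- Algebra.Solver.Ring needs coefficients with a usable equality test; ℤ maps into every
-- commutative ring, so integer coefficients serve for all of them.
module IntegerCoefficientSolver {c ℓ} (R : CommutativeRing c ℓ) where
  open CommutativeRing R
  open import Algebra.Properties.Semiring.Mult.TCOptimised semiring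
    renaming (_×_ to _⊠_) using (×-homo-+; ×1-homo-*; 1+×)
  open import Algebra.Properties.Ring ring using (-‿distribˡ-*; -‿involutive; -0#≈0#; -1*x≈-x)
  open import Algebra.Properties.AbelianGroup +-abelianGroup using (⁻¹-∙-comm)
  open import Algebra.Properties.CommutativeSemigroup +-commutativeSemigroup
    renaming (interchange to +-interchange) using ()
  open import Algebra.Properties.CommutativeSemigroup *-commutativeSemigroup
    renaming (interchange to *-interchange) using ()
  open import Relation.Binary.Reasoning.Setoid setoid

  fromℤ : ℤ → Carrier
  fromℤ (+ n)    = n ⊠ 1#
  fromℤ -[1+ n ] = - (suc n ⊠ 1#)

  private
    signed : Sign → Carrier
    signed Sign.+ = 1#
    signed Sign.- = - 1#

    fromℤ-neg : ∀ i → fromℤ (ℤ.- i) ≈ - fromℤ i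
    fromℤ-neg (+ zero)  = sym -0#≈0#
    fromℤ-neg (+ suc n) = refl
    fromℤ-neg -[1+ n ]  = sym (-‿involutive _)

    fromℤ-⊖ : ∀ m n → fromℤ (m ⊖ n) ≈ m ⊠ 1# - n ⊠ 1#
    fromℤ-⊖ zero    zero    = sym (-‿inverseʳ 0#)
    fromℤ-⊖ zero    (suc n) = sym (+-identityˡ _)
    fromℤ-⊖ (suc m) zero    = sym (trans (+-congˡ -0#≈0#) (+-identityʳ _))
    fromℤ-⊖ (suc m) (suc n) = begin
      fromℤ (suc m ⊖ suc n)                 ≡⟨ ≡.cong fromℤ (ℤ.[1+m]⊖[1+n]≡m⊖n m n) ⟩
      fromℤ (m ⊖ n)                         ≈⟨ fromℤ-⊖ m n ⟩
      m ⊠ 1# - n ⊠ 1#                       ≈⟨ +-identityˡ _ ⟨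
      0# + (m ⊠ 1# - n ⊠ 1#)                ≈⟨ +-congʳ (-‿inverseʳ 1#) ⟨
      (1# - 1#) + (m ⊠ 1# - n ⊠ 1#)         ≈⟨ +-interchange 1# (- 1#) _ _ ⟩
      (1# + m ⊠ 1#) + (- 1# - n ⊠ 1#)       ≈⟨ +-congˡ (⁻¹-∙-comm 1# _) ⟩
      (1# + m ⊠ 1#) - (1# + n ⊠ 1#)         ≈⟨ +-cong (1+× m 1#) (-‿cong (1+× n 1#)) ⟨
      suc m ⊠ 1# - suc n ⊠ 1#               ∎

    fromℤ-◃ : ∀ s n → fromℤ (s ℤ.◃ n) ≈ signed s * (n ⊠ 1#)
    fromℤ-◃ s       zero    = sym (zeroʳ _)
    fromℤ-◃ Sign.+  (suc n) = sym (*-identityˡ _)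
    fromℤ-◃ Sign.-  (suc n) = sym (-1*x≈-x _)

    fromℤ-sign : ∀ i → fromℤ i ≈ signed (ℤ.sign i) * (ℤ.∣ i ∣ ⊠ 1#)
    fromℤ-sign (+ n)    = sym (*-identityˡ _)
    fromℤ-sign -[1+ n ] = fromℤ-◃ Sign.- (suc n)

    signed-* : ∀ s t → signed (s Sign.* t) ≈ signed s * signed t
    signed-* Sign.+ t      = sym (*-identityˡ _)
    signed-* Sign.- Sign.+ = sym (*-identityʳ _)
    signed-* Sign.- Sign.- = trans (sym (-‿involutive 1#)) (sym (-1*x≈-x (- 1#)))

    fromℤ-+ : ∀ i j → fromℤ (i ℤ.+ j) ≈ fromℤ i + fromℤ j
    fromℤ-+ (+ m)    (+ n)    = ×-homo-+ 1# m n
    fromℤ-+ (+ m)    -[1+ n ] = fromℤ-⊖ m (suc n)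
    fromℤ-+ -[1+ m ] (+ n)    = trans (fromℤ-⊖ n (suc m)) (+-comm _ _)
    fromℤ-+ -[1+ m ] -[1+ n ] = begin
      - (suc (suc (m ℕ.+ n)) ⊠ 1#)    ≡⟨ ≡.cong (λ k → - (k ⊠ 1#)) (ℕ.+-suc (suc m) n) ⟨
      - ((suc m ℕ.+ suc n) ⊠ 1#)      ≈⟨ -‿cong (×-homo-+ 1# (suc m) (suc n)) ⟩
      - (suc m ⊠ 1# + suc n ⊠ 1#)     ≈⟨ ⁻¹-∙-comm _ _ ⟨
      - (suc m ⊠ 1#) - (suc n ⊠ 1#)   ∎

    fromℤ-* : ∀ i j → fromℤ (i ℤ.* j) ≈ fromℤ i * fromℤ j
    fromℤ-* i j = begin
      fromℤ (ℤ.sign i Sign.* ℤ.sign j ℤ.◃ ℤ.∣ i ∣ ℕ.* ℤ.∣ j ∣)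
        ≈⟨ fromℤ-◃ (ℤ.sign i Sign.* ℤ.sign j) (ℤ.∣ i ∣ ℕ.* ℤ.∣ j ∣) ⟩
      signed (ℤ.sign i Sign.* ℤ.sign j) * ((ℤ.∣ i ∣ ℕ.* ℤ.∣ j ∣) ⊠ 1#)
        ≈⟨ *-cong (signed-* (ℤ.sign i) (ℤ.sign j)) (×1-homo-* ℤ.∣ i ∣ ℤ.∣ j ∣) ⟩
      (signed (ℤ.sign i) * signed (ℤ.sign j)) * ((ℤ.∣ i ∣ ⊠ 1#) * (ℤ.∣ j ∣ ⊠ 1#))
        ≈⟨ *-interchange _ _ _ _ ⟩
      (signed (ℤ.sign i) * (ℤ.∣ i ∣ ⊠ 1#)) * (signed (ℤ.sign j) * (ℤ.∣ j ∣ ⊠ 1#))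
        ≈⟨ *-cong (fromℤ-sign i) (fromℤ-sign j) ⟨
      fromℤ i * fromℤ j ∎

    fromℤ-homomorphism : ℤ.+-*-rawRing ACR.-Raw-AlmostCommutative⟶ ACR.fromCommutativeRing R
    fromℤ-homomorphism = record
      { ⟦_⟧ = fromℤ ; +-homo = fromℤ-+ ; *-homo = fromℤ-* ; -‿homo = fromℤ-neg
      ; 0-homo = refl ; 1-homo = refl }

    fromℤ-≟ : ∀ i j → Maybe (fromℤ i ≈ fromℤ j)
    fromℤ-≟ i j with i ℤ.≟ j
    ... | yes i≡j = just (reflexive (≡.cong fromℤ i≡j))
    ... | no _    = nothing

  open import Algebra.Solver.Ring ℤ.+-*-rawRing (ACR.fromCommutativeRing R) fromℤ-homomorphism fromℤ-≟ public

module CongruenceModuloIdeal2 {c ℓ} (R : CommutativeRing c ℓ) (u v : CommutativeRing.Carrier R) where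
  open CommutativeRing R
  open RingNotions R
  open IntegerCoefficientSolver R using (solve; _:=_; _:+_; _:*_; _:-_; con)

  private
    variable
      x y z w : Carrier

    ∈-resp : x ≈ y → InIdeal2 u v x → InIdeal2 u v y
    ∈-resp x≈y (a , b , x≈au+bv) = a , b , trans (sym x≈y) x≈au+bv

    ∈-+ : InIdeal2 u v x → InIdeal2 u v y → InIdeal2 u v (x + y)
    ∈-+ (a , b , p) (a′ , b′ , p′) = a + a′ , b + b′ , trans (+-cong p p′)
      (solve 6 (λ a b a′ b′ u v → (a :* u :+ b :* v) :+ (a′ :* u :+ b′ :* v)
                                  := (a :+ a′) :* u :+ (b :+ b′) :* v) refl a b a′ b′ u v)

    ∈-*ˡ : ∀ z → InIdeal2 u v x → InIdeal2 u v (z * x)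
    ∈-*ˡ z (a , b , p) = z * a , z * b , trans (*-congˡ p)
      (solve 5 (λ z a b u v → z :* (a :* u :+ b :* v) := (z :* a) :* u :+ (z :* b) :* v) refl z a b u v)

  infix 4 _≋_
  _≋_ : Rel Carrier (c Level.⊔ ℓ)
  x ≋ y = InIdeal2 u v (x - y)

  ≋-reflexive : x ≈ y → x ≋ y
  ≋-reflexive {x} {y} x≈y = 0# , 0# , trans (+-congʳ x≈y)
    (solve 3 (λ y u v → y :- y := con (+ 0) :* u :+ con (+ 0) :* v) refl y u v)

  ≋-refl : x ≋ x
  ≋-refl = ≋-reflexive refl

  ≋-sym : x ≋ y → y ≋ x
  ≋-sym {x} {y} = ∈-resp (solve 2 (λ x y → con (-[1+ 0 ]) :* (x :- y) := y :- x) refl x y) ∘ ∈-*ˡ (- 1#)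

  ≋-trans : x ≋ y → y ≋ z → x ≋ z
  ≋-trans {x} {y} {z} p q = ∈-resp (solve 3 (λ x y z → (x :- y) :+ (y :- z) := x :- z) refl x y z) (∈-+ p q)

  ≋-preorder : Preorder c ℓ (c Level.⊔ ℓ)
  ≋-preorder = record
    { isPreorder = record { isEquivalence = isEquivalence ; reflexive = ≋-reflexive ; trans = ≋-trans } }

  module ≋-Reasoning = Relation.Binary.Reasoning.Preorder ≋-preorder

  ≋-+-cong : x ≋ y → z ≋ w → x + z ≋ y + w
  ≋-+-cong {x} {y} {z} {w} p q =
    ∈-resp (solve 4 (λ x y z w → (x :- y) :+ (z :- w) := (x :+ z) :- (y :+ w)) refl x y z w) (∈-+ p q)

  ≋-*-cong : x ≋ y → z ≋ w → x * z ≋ y * w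
  ≋-*-cong {x} {y} {z} {w} p q =
    ∈-resp (solve 4 (λ x y z w → z :* (x :- y) :+ y :* (z :- w) := x :* z :- y :* w) refl x y z w)
           (∈-+ (∈-*ˡ z p) (∈-*ˡ y q))

  u≋0 : u ≋ 0#
  u≋0 = 1# , 0# , solve 2 (λ u v → u :- con (+ 0) := con (+ 1) :* u :+ con (+ 0) :* v) refl u v

  v≋0 : v ≋ 0#
  v≋0 = 0# , 1# , solve 2 (λ u v → v :- con (+ 0) := con (+ 0) :* u :+ con (+ 1) :* v) refl u v

  ≋0-+ : x ≋ 0# → y ≋ 0# → x + y ≋ 0#
  ≋0-+ p q = ≋-trans (≋-+-cong p q) (≋-reflexive (+-identityʳ 0#))

  ≋0-*ˡ : ∀ z → x ≋ 0# → z * x ≋ 0#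
  ≋0-*ˡ z p = ≋-trans (≋-*-cong ≋-refl p) (≋-reflexive (zeroʳ z))

  ≋0-*ʳ : ∀ z → x ≋ 0# → x * z ≋ 0#
  ≋0-*ʳ z p = ≋-trans (≋-*-cong p ≋-refl) (≋-reflexive (zeroˡ z))

  ≋1-^ : x ≋ 1# → ∀ n → x ^ n ≋ 1#
  ≋1-^ p zero    = ≋-refl
  ≋1-^ p (suc n) = ≋-trans (≋-*-cong p (≋1-^ p n)) (≋-reflexive (*-identityˡ 1#))

  1≋0⇒isUnit : InJacobson v → 1# ≋ 0# → IsUnit u
  1≋0⇒isUnit v∈Rad (a , b , 1-0≈au+bv) with v∈Rad b
  ... | w , [1-bv]w≈1 = a * w , (begin
    u * (a * w)                        ≈⟨ solve 5 (λ u a w b v → u :* (a :* w) := (((a :* u :+ b :* v) :- b :* v)) :* w)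
                                                refl u a w b v ⟩
    ((a * u + b * v) - b * v) * w      ≈⟨ *-congʳ (+-congʳ 1-0≈au+bv) ⟨
    ((1# - 0#) - b * v) * w            ≈⟨ *-congʳ (+-congʳ (solve 0 (con (+ 1) :- con (+ 0) := con (+ 1)) refl)) ⟩
    (1# - b * v) * w                   ≈⟨ [1-bv]w≈1 ⟩
    1#                                 ∎)
    where open import Relation.Binary.Reasoning.Setoid setoid

2≤residueFieldSize : ∀ {c ℓ} {O : CommutativeRing c ℓ} {π : CommutativeRing.Carrier O} {q : ℕ}
                   → IsIntegersOfLocalField O π q → 2 ≤ q
2≤residueFieldSize {π = π} {q = zero} I with IsIntegersOfLocalField.residueOnto I π
... | () , _
2≤residueFieldSize {O = O} {π} {q = suc zero} I =
  ⊥-elim (π-nonunit (one-residue-class⇒π-unit (residueOnto 0#) (residueOnto 1#)))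
  where
  open CommutativeRing O
  open RingNotions O
  open IsIntegersOfLocalField I
  open IntegerCoefficientSolver O using (solve; _:=_; _:-_; con)
  open import Algebra.Properties.Ring ring using (x[y-z]≈xy-xz)
  open import Relation.Binary.Reasoning.Setoid setoid

  one-residue-class⇒π-unit : (∃ λ i → π ∣ᴿ (0# - residueRep i)) → (∃ λ i → π ∣ᴿ (1# - residueRep i)) → IsUnit π
  one-residue-class⇒π-unit (Fin.zero , k₀ , 0-r≈πk₀) (Fin.zero , k₁ , 1-r≈πk₁) = k₁ - k₀ , (begin
    π * (k₁ - k₀)         ≈⟨ x[y-z]≈xy-xz π k₁ k₀ ⟩
    π * k₁ - π * k₀       ≈⟨ +-cong 1-r≈πk₁ (-‿cong 0-r≈πk₀) ⟨
    (1# - r) - (0# - r)   ≈⟨ solve 1 (λ r → (con (+ 1) :- r) :- (con (+ 0) :- r) := con (+ 1)) refl r ⟩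
    1#                    ∎)
    where r = residueRep Fin.zero
2≤residueFieldSize {q = suc (suc k)} I = s≤s (s≤s z≤n)

module DistinguishedCriteria {c ℓ a ℓ′} (O : CommutativeRing c ℓ) (π : CommutativeRing.Carrier O) (k : ℕ)
                             (D : DeltaLAlgebra O π (2 ℕ.+ k) a ℓ′)
                             (d : CommutativeRing.Carrier (DeltaLAlgebra.A D))
                             (d∈Rad : RingNotions.InJacobson (DeltaLAlgebra.A D) d) where
  open DeltaLAlgebra D
  open CommutativeRing A
  open RingNotions A
  open RingMorphisms (CommutativeRing.rawRing O) rawRing
  open IsRingHomomorphism ι-hom
  open import Algebra.Properties.Ring ring using (-‿distribˡ-*; -‿distribʳ-*)
  open IntegerCoefficientSolver A using (solve; _:=_; _:+_; _:*_; :-_; _:-_; con)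
  private
    module O = CommutativeRing O
    module OR = RingNotions O

  ι-^ : ∀ x n → ι (x OR.^ n) ≈ ι x ^ n
  ι-^ x zero    = 1#-homo
  ι-^ x (suc n) = trans (*-homo x (x OR.^ n)) (*-congˡ (ι-^ x n))

  δ-ιπ : δ (ι π) ≈ 1# - ι π ^ suc k
  δ-ιπ = begin
    δ (ι π)                     ≈⟨ δ-const π (O.1# O.- π OR.^ suc k) π[1-π^[1+k]]≈π-π^[2+k] ⟩
    ι (O.1# O.- π OR.^ suc k)   ≈⟨ +-homo O.1# _ ⟩
    ι O.1# + ι (O.- π OR.^ suc k) ≈⟨ +-cong 1#-homo (trans (-‿homo _) (-‿cong (ι-^ π (suc k)))) ⟩
    1# - ι π ^ suc k            ∎
    where
    open import Relation.Binary.Reasoning.Setoid setoid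
    open import Algebra.Properties.Ring O.ring using (x[y-z]≈xy-xz)
    π[1-π^[1+k]]≈π-π^[2+k] : π O.* (O.1# O.- π OR.^ suc k) O.≈ π O.- π OR.^ (2 ℕ.+ k)
    π[1-π^[1+k]]≈π-π^[2+k] = O.trans (x[y-z]≈xy-xz π O.1# _) (O.+-congʳ (O.*-identityʳ π))

  open CongruenceModuloIdeal2 A (δ d) d renaming (u≋0 to δd≋0; v≋0 to d≋0)
  open ≋-Reasoning

  φd≋0 : φ d ≋ 0#
  φd≋0 = ≋0-+ (≋0-*ʳ _ d≋0) (≋0-*ˡ _ δd≋0)

  δ-multiple≋0 : ∀ f → δ (f * d) ≋ 0#
  δ-multiple≋0 f = begin
    δ (f * d)                                        ≈⟨ δ-mul f d ⟩
    δ f * d ^ (2 ℕ.+ k) + f ^ (2 ℕ.+ k) * δ d + ι π * δ f * δ d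
      ∼⟨ ≋0-+ (≋0-+ (≋0-*ˡ (δ f) (≋0-*ʳ _ d≋0)) (≋0-*ˡ _ δd≋0)) (≋0-*ˡ _ δd≋0) ⟩
    0#                                               ∎

  distinguished⇒multiple-distinguished : Distinguished d → ∃ λ e → InPrincipal d e × Distinguished e
  distinguished⇒multiple-distinguished dist = d , (1# , sym (*-identityˡ d)) , dist

  multiple-distinguished⇒distinguished : (∃ λ e → InPrincipal d e × Distinguished e) → Distinguished d
  multiple-distinguished⇒distinguished (e , (f , e≈fd) , w , δe*w≈1) = 1≋0⇒isUnit d∈Rad (begin
    1#              ≈⟨ δe*w≈1 ⟨
    δ e * w         ≈⟨ *-congʳ (δ-cong e≈fd) ⟩
    δ (f * d) * w   ∼⟨ ≋0-*ʳ w (δ-multiple≋0 f) ⟩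
    0#              ∎)

  distinguished⇒π∈⟨d^q,φd⟩ : Distinguished d → InIdeal2 (d ^ (2 ℕ.+ k)) (φ d) (ι π)
  distinguished⇒π∈⟨d^q,φd⟩ (v , δd*v≈1) = - v , v , (begin-equality
    ι π                                ≈⟨ *-identityʳ _ ⟨
    ι π * 1#                           ≈⟨ *-congˡ δd*v≈1 ⟨
    ι π * (δ d * v)                    ≈⟨ solve 4 (λ p D v dq → p :* (D :* v) := (:- v) :* dq :+ v :* (dq :+ p :* D))
                                                  refl (ι π) (δ d) v (d ^ (2 ℕ.+ k)) ⟩
    - v * d ^ (2 ℕ.+ k) + v * φ d      ∎)

  π∈⟨d^q,φd⟩⇒π∈⟨d,φd⟩ : InIdeal2 (d ^ (2 ℕ.+ k)) (φ d) (ι π) → InIdeal2 d (φ d) (ι π)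
  π∈⟨d^q,φd⟩⇒π∈⟨d,φd⟩ (a , b , π≈ad^q+bφd) = a * d ^ suc k , b ,
    trans π≈ad^q+bφd (+-congʳ (trans (*-congˡ (*-comm d _)) (sym (*-assoc a _ d))))

  π∈⟨d,φd⟩⇒distinguished : InIdeal2 d (φ d) (ι π) → Distinguished d
  π∈⟨d,φd⟩⇒distinguished (a , b , π≈ad+bφd) = 1≋0⇒isUnit d∈Rad 1≋0
    where
    u s : Carrier
    u = 1# - b * δ d
    s = a + b * d ^ suc k

    π≋0 : ι π ≋ 0#
    π≋0 = ≋-trans (≋-reflexive π≈ad+bφd) (≋0-+ (≋0-*ˡ a d≋0) (≋0-*ˡ b φd≋0))

    u≋1 : u ≋ 1#
    u≋1 = begin
      1# - b * δ d       ≈⟨ +-congˡ (-‿distribˡ-* b (δ d)) ⟩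
      1# + - b * δ d     ∼⟨ ≋-+-cong ≋-refl (≋0-*ˡ (- b) δd≋0) ⟩
      1# + 0#            ≈⟨ +-identityʳ 1# ⟩
      1#                 ∎

    δπ≋1 : δ (ι π) ≋ 1#
    δπ≋1 = begin
      δ (ι π)                  ≈⟨ δ-ιπ ⟩
      1# - ι π * ι π ^ k       ≈⟨ +-congˡ (-‿distribʳ-* (ι π) _) ⟩
      1# + ι π * - ι π ^ k     ∼⟨ ≋-+-cong ≋-refl (≋0-*ʳ _ π≋0) ⟩
      1# + 0#                  ≈⟨ +-identityʳ 1# ⟩
      1#                       ∎

    πu≈sd : ι π * u ≈ s * d
    πu≈sd = begin-equality
      ι π * (1# - b * δ d)                   ≈⟨ solve 3 (λ p b D → p :* (con (+ 1) :- b :* D) := p :- b :* p :* D)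
                                                         refl (ι π) b (δ d) ⟩
      ι π - b * ι π * δ d                    ≈⟨ +-congʳ π≈ad+bφd ⟩
      (a * d + b * φ d) - b * ι π * δ d      ≈⟨ solve 6 (λ a b d dk p D → (a :* d :+ b :* (d :* (d :* dk) :+ p :* D))
                                                                           :- b :* p :* D := (a :+ b :* (d :* dk)) :* d)
                                                         refl a b d (d ^ k) (ι π) (δ d) ⟩
      s * d                                  ∎

    1≋0 : 1# ≋ 0#
    1≋0 = begin
      1#                                                   ∼⟨ ≋-sym (≋1-^ u≋1 (2 ℕ.+ k)) ⟩
      u ^ (2 ℕ.+ k)                                        ≈⟨ *-identityˡ _ ⟨
      1# * u ^ (2 ℕ.+ k)                                   ∼⟨ ≋-*-cong (≋-sym δπ≋1) ≋-refl ⟩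
      δ (ι π) * u ^ (2 ℕ.+ k)                              ≈⟨ +-identityʳ _ ⟨
      δ (ι π) * u ^ (2 ℕ.+ k) + 0#                         ∼⟨ ≋-+-cong ≋-refl (≋-sym (≋0-+ (≋0-*ʳ _ (≋0-*ʳ _ π≋0))
                                                                                            (≋0-*ʳ _ (≋0-*ʳ _ π≋0)))) ⟩
      δ (ι π) * u ^ (2 ℕ.+ k) + (ι π ^ (2 ℕ.+ k) * δ u + ι π * δ (ι π) * δ u)
                                                           ≈⟨ +-assoc _ _ _ ⟨
      δ (ι π) * u ^ (2 ℕ.+ k) + ι π ^ (2 ℕ.+ k) * δ u + ι π * δ (ι π) * δ u
                                                           ≈⟨ δ-mul (ι π) u ⟨
      δ (ι π * u)                                          ≈⟨ δ-cong πu≈sd ⟩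
      δ (s * d)                                            ∼⟨ δ-multiple≋0 s ⟩
      0#                                                   ∎

lemma2p9 : ∀ {c ℓ a ℓ′ : Level} (O : CommutativeRing c ℓ) (π : CommutativeRing.Carrier O) (q : ℕ)
           → IsIntegersOfLocalField O π q
           → (D : DeltaLAlgebra O π q a ℓ′)
           → let open DeltaLAlgebra D
                 open CommutativeRing A
                 open RingNotions A
             in (d : Carrier) → InJacobson d
             → (Distinguished d ⇔ (∃ λ e → InPrincipal d e × Distinguished e))
             × (Distinguished d ⇔ InIdeal2 (d ^ q) (φ d) (ι π))
             × (Distinguished d ⇔ InIdeal2 d (φ d) (ι π))
lemma2p9 O π q I D d d∈Rad with 2≤residueFieldSize I
... | s≤s (s≤s {n = k} _) =
    mk⇔ distinguished⇒multiple-distinguished multiple-distinguished⇒distinguished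
  , mk⇔ distinguished⇒π∈⟨d^q,φd⟩ (π∈⟨d,φd⟩⇒distinguished ∘ π∈⟨d^q,φd⟩⇒π∈⟨d,φd⟩)
  , mk⇔ (π∈⟨d^q,φd⟩⇒π∈⟨d,φd⟩ ∘ distinguished⇒π∈⟨d^q,φd⟩) π∈⟨d,φd⟩⇒distinguished
  where open DistinguishedCriteria O π k D d d∈Rad
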